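{- $k=7$ and every integer $k \ge 9$ collapse for $\mathcal{T}$.
   Context: For a graph $G$, a weighing is a function $w: E(G) \to \{ -1,1\}$, and for a subgraph $H$, $w(H)=\sum_{e\in E(H)} w(e)$. For a positive integer $k$, $w$ is $k$-local positive if $w(H)>0$ for every connected subgraph $H$ of $G$ with exactly $k$ edges. For an infinite family $\mathcal{G}$ of connected graphs, $k$ is forcing for $\mathcal{G}$ if for all but finitely many $G \in \mathcal{G}$, every $k$-local positive weighing $w$ of $G$ satisfies $w(G)>0$; $k$ is weakly forcing for $\mathcal{G}$ if it is not forcing but there is a constant $C$ such that for all but finitely many $G\in\mathcal{G}$, every $k$-local positive weighing $w$ of $G$ has $w(G)\ge C$; and $k$ collapses for $\mathcal{G}$ if it is neither forcing nor weakly forcing. $\mathcal{T}$ is the family of all (finite) trees. -}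

module Defs where

open import Data.Nat using (ℕ; zero; suc) renaming (_≤_ to _≤ℕ_)
open import Data.Fin using (Fin)
open import Data.Fin.Subset using (Subset; _∈_; ∣_∣; ⊤; inside; outside)
open import Data.Integer using (ℤ; +_; _+_; _<_; _≤_; 1ℤ; -1ℤ)
open import Data.Sign using (Sign)
open import Data.Product using (_×_; _,_; Σ; ∃; ∃-syntax)
open import Data.Sum using (_⊎_)
open import Data.List using (List; []; _∷_)
open import Data.List.Relation.Unary.All using (All)
open import Data.List.Relation.Unary.Unique.Propositional using (Unique)
open import Data.Vec using (_∷_; [])
open import Relation.Binary.PropositionalEquality using (_≡_)
open import Relation.Nullary using (¬_)

record Graph : Set where
  field
    n    : ℕ
    m    : ℕ
    ends : Fin m → Fin n × Fin n

open Graph public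

module _ (G : Graph) where

  Joins : Fin (m G) → Fin (n G) → Fin (n G) → Set
  Joins e u v = ends G e ≡ (u , v) ⊎ ends G e ≡ (v , u)

  data Walk : Fin (n G) → Fin (n G) → Set where
    nil  : ∀ {u} → Walk u u
    cons : ∀ {u v w} (e : Fin (m G)) → Joins e u v → Walk v w → Walk u w

  walkEdges : ∀ {u v} → Walk u v → List (Fin (m G))
  walkEdges nil = []
  walkEdges (cons e _ p) = e ∷ walkEdges p

  -- vertices at which the steps start (for a closed walk: each vertex once, last omitted)
  walkVerts : ∀ {u v} → Walk u v → List (Fin (n G))
  walkVerts nil = []
  walkVerts (cons {u} e _ p) = u ∷ walkVerts p

  Connected : Set
  Connected = ∀ u v → Walk u v

  IsCycle : ∀ {u} → Walk u u → Set
  IsCycle nil = Data.Empty.⊥ where import Data.Empty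
  IsCycle p@(cons _ _ _) = Unique (walkEdges p) × Unique (walkVerts p)

  Acyclic : Set
  Acyclic = ∀ u (p : Walk u u) → ¬ IsCycle p

  IsTree : Set
  IsTree = Connected × Acyclic

  IsSubgraph : Subset (n G) → Subset (m G) → Set
  IsSubgraph U S = ∀ e → e ∈ S → (Data.Product.proj₁ (ends G e) ∈ U) × (Data.Product.proj₂ (ends G e) ∈ U)
    where import Data.Product

  ConnectedSub : Subset (n G) → Subset (m G) → Set
  ConnectedSub U S = ∀ u v → u ∈ U → v ∈ U → Σ (Walk u v) (λ p → All (_∈ S) (walkEdges p))

signVal : Sign → ℤ
signVal Sign.+ = 1ℤ
signVal Sign.- = -1ℤ

Weighing : Graph → Set
Weighing G = Fin (m G) → Sign

wsum : ∀ {k} → (Fin k → Sign) → Subset k → ℤ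
wsum {zero} w [] = + 0
wsum {suc k} w (inside ∷ S) = signVal (w Fin.zero) + wsum (λ i → w (Fin.suc i)) S
  where import Data.Fin as Fin
wsum {suc k} w (outside ∷ S) = wsum (λ i → w (Fin.suc i)) S
  where import Data.Fin as Fin

weightOf : (G : Graph) → Weighing G → Subset (m G) → ℤ
weightOf G w S = wsum w S

totalWeight : (G : Graph) → Weighing G → ℤ
totalWeight G w = wsum w ⊤

LocalPositive : ℕ → (G : Graph) → Weighing G → Set
LocalPositive k G w =
  ∀ (U : Subset (n G)) (S : Subset (m G)) →
    IsSubgraph G U S → ConnectedSub G U S → ∣ S ∣ ≡ k →
    + 0 < weightOf G w S

-- "for all but finitely many trees" (trees up to isomorphism): for all trees with at least N vertices
Forcing : ℕ → Set
Forcing k = ∃[ N ] ∀ (G : Graph) → IsTree G → N ≤ℕ n G →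
  ∀ (w : Weighing G) → LocalPositive k G w → + 0 < totalWeight G w

WeaklyForcing : ℕ → Set
WeaklyForcing k = ¬ Forcing k ×
  (∃[ C ] ∃[ N ] ∀ (G : Graph) → IsTree G → N ≤ℕ n G →
    ∀ (w : Weighing G) → LocalPositive k G w → C ≤ totalWeight G w)

Collapses : ℕ → Set
Collapses k = ¬ Forcing k × ¬ WeaklyForcing k

module Submission where

-- Witnesses are spiders: d legs, each a path of 2p + 1 edges whose p edges nearest the
-- centre weigh +1 and whose remaining p + 1 edges weigh -1, so the total weight is -d.
-- If 3 + 2p ≤ k < 4p, every connected subgraph H with k edges is positive: H is longer
-- than a leg, so it cannot avoid the centre and meets every leg in an initial segment;
-- hence each leg on which H has a negative edge contributes all p of its positive edges
-- and at most p + 1 negative ones, and the bounds on k leave no room for a non-positive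
-- balance.  Such a p exists for k = 7 (p = 2) and for every k ≥ 9.  Since d is arbitrary,
-- the weight of large trees under k-local positive weighings is unbounded below, which
-- excludes both forcing and weak forcing.

open import Defs
open import Data.Nat using (ℕ; zero; suc; _+_; _*_; _∸_; _≤_; _<_; _≮_; z≤n; s≤s; s≤s⁻¹; z<s; _<ᵇ_; _<?_)
import Data.Nat.Properties as ℕₚ
open import Data.Bool using (Bool; true; false; _∧_; not; if_then_else_)
import Data.Bool.Properties as Boolₚ
open import Data.Fin as Fin using (Fin; toℕ; combine; remQuot; inject₁; _↑ˡ_; _↑ʳ_)
import Data.Fin.Properties as Finₚ
open import Data.Fin.Induction using (<-weakInduction)
open import Data.Fin.Subset using (Subset; _∈_; ∣_∣; ⊤)
open import Data.Vec using ([]; _∷_; lookup)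
import Data.Vec.Properties as Vecₚ
import Data.Integer as ℤ
open ℤ using (_⊖_)
import Data.Integer.Properties as ℤₚ
open import Data.Sign using (Sign)
open import Data.Product using (Σ; ∃; _×_; _,_; proj₁; proj₂; uncurry)
open import Data.Sum using (_⊎_; inj₁; inj₂)
open import Data.Unit using (tt)
open import Data.List.Membership.Propositional using () renaming (_∈_ to _∈ₗ_)
open import Data.List.Relation.Unary.Any using (here; there)
import Data.List.Relation.Unary.All as All
open import Data.List.Relation.Unary.AllPairs using (_∷_)
open import Function using (_∘_; _∘′_; id)
open import Relation.Binary.PropositionalEquality
open import Relation.Nullary using (¬_; yes; no; does; contradiction)
open import Relation.Nullary.Decidable using (dec-true; dec-false)
open import Algebra.Properties.Semiring.Sum ℕₚ.+-*-semiring
  using (sum; sum-syntax; sum-cong-≗; ∑-distrib-+; *-distribʳ-sum)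

ind : Bool → ℕ
ind true = 1
ind false = 0

count : ∀ {n} → (Fin n → Bool) → ℕ
count {n} b = ∑[ i < n ] ind (b i)

ind-split : ∀ b c → ind b ≡ ind (b ∧ c) + ind (b ∧ not c)
ind-split true true = refl
ind-split true false = refl
ind-split false c = refl

ind-∧≤ʳ : ∀ b c → ind (b ∧ c) ≤ ind c
ind-∧≤ʳ true c = ℕₚ.≤-refl
ind-∧≤ʳ false c = z≤n

ind≤1 : ∀ b → ind b ≤ 1
ind≤1 true = ℕₚ.≤-refl
ind≤1 false = z≤n

ind-∧-pos : ∀ b c → 0 < ind (b ∧ c) → b ≡ true × c ≡ true
ind-∧-pos true true _ = refl , refl

sum-mono : ∀ {n} {f g : Fin n → ℕ} → (∀ i → f i ≤ g i) → sum f ≤ sum g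
sum-mono {zero} f≤g = z≤n
sum-mono {suc n} f≤g = ℕₚ.+-mono-≤ (f≤g Fin.zero) (sum-mono (f≤g ∘ Fin.suc))

sum-const : ∀ n c → ∑[ i < n ] c ≡ n * c
sum-const zero c = refl
sum-const (suc n) c = cong (c +_) (sum-const n c)

sum-zero : ∀ {n} {f : Fin n → ℕ} → (∀ i → f i ≡ 0) → sum f ≡ 0
sum-zero {zero} f≡0 = refl
sum-zero {suc n} f≡0 = cong₂ _+_ (f≡0 Fin.zero) (sum-zero (f≡0 ∘ Fin.suc))

sum-single : ∀ {n} (f : Fin n → ℕ) i → (∀ j → j ≢ i → f j ≡ 0) → sum f ≡ f i
sum-single {suc n} f Fin.zero vanish =
  trans (cong (f Fin.zero +_) (sum-zero (λ j → vanish (Fin.suc j) λ ()))) (ℕₚ.+-identityʳ _)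
sum-single {suc n} f (Fin.suc i) vanish =
  cong₂ _+_ (vanish Fin.zero λ ())
            (sum-single (f ∘ Fin.suc) i λ j j≢i → vanish (Fin.suc j) (j≢i ∘ Finₚ.suc-injective))

sum-pos : ∀ {n} (f : Fin n → ℕ) → 0 < sum f → ∃ λ i → 0 < f i
sum-pos {suc n} f 0<sum with f Fin.zero in eq
... | suc _ = Fin.zero , subst (0 <_) (sym eq) (s≤s z≤n)
... | zero with sum-pos (f ∘ Fin.suc) 0<sum
...   | i , 0<fi = Fin.suc i , 0<fi

sum-combine : ∀ d L (f : Fin (d * L) → ℕ) → sum f ≡ ∑[ i < d ] ∑[ t < L ] f (combine i t)
sum-combine zero L f = refl
sum-combine (suc d) L f =
  trans (sum-↑ L (d * L) f)
        (cong (∑[ t < L ] f (t ↑ˡ (d * L)) +_) (sum-combine d L (f ∘ (L ↑ʳ_))))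
  where
  sum-↑ : ∀ a b (g : Fin (a + b) → ℕ) → sum g ≡ ∑[ i < a ] g (i ↑ˡ b) + ∑[ j < b ] g (a ↑ʳ j)
  sum-↑ zero b g = refl
  sum-↑ (suc a) b g =
    trans (cong (g Fin.zero +_) (sum-↑ a b (g ∘ Fin.suc))) (sym (ℕₚ.+-assoc (g Fin.zero) _ _))

count-below : ∀ n p → p ≤ n → count {n} (λ t → toℕ t <ᵇ p) ≡ p
count-below n zero _ = sum-zero {n} (λ _ → refl)
count-below (suc n) (suc p) (s≤s p≤n) = cong suc (count-below n p p≤n)

count-split : ∀ {n} (a b : Fin n → Bool) →
  count a ≡ count (λ e → a e ∧ b e) + count (λ e → a e ∧ not (b e))
count-split a b = trans (sum-cong-≗ (λ e → ind-split (a e) (b e)))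
  (∑-distrib-+ (λ e → ind (a e ∧ b e)) (λ e → ind (a e ∧ not (b e))))

card-count : ∀ {n} (S : Subset n) → ∣ S ∣ ≡ count (lookup S)
card-count [] = refl
card-count (true ∷ S) = cong suc (card-count S)
card-count (false ∷ S) = card-count S

-- Every weighing has the form sign ∘ b, with b marking the edges of weight +1.
sign : Bool → Sign
sign true = Sign.+
sign false = Sign.-

sign-step : ∀ c P N → signVal (sign c) ℤ.+ (P ⊖ N) ≡ (ind c + P) ⊖ (ind (not c) + N)
sign-step true P N = ℤₚ.distribʳ-⊖-+-pos 1 P N
sign-step false P N = ℤₚ.distribʳ-⊖-+-neg 0 P N

wsum-sign : ∀ {n} (b : Fin n → Bool) (S : Subset n) →
  wsum (sign ∘ b) S ≡ count (λ e → lookup S e ∧ b e) ⊖ count (λ e → lookup S e ∧ not (b e))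
wsum-sign b [] = refl
wsum-sign b (false ∷ S) = wsum-sign (b ∘ Fin.suc) S
wsum-sign b (true ∷ S) =
  trans (cong (ℤ._+_ (signVal (sign (b Fin.zero)))) (wsum-sign (b ∘ Fin.suc) S))
        (sign-step (b Fin.zero) _ _)

⊖-pos : ∀ {m n} → n < m → ℤ.+ 0 ℤ.< m ⊖ n
⊖-pos {m} {n} n<m = subst (ℤ._< m ⊖ n) (ℤₚ.n⊖n≡0 n) (ℤₚ.⊖-monoˡ-< n n<m)

module _ (G : Graph) where

  joins-sym : ∀ {e u v} → Joins G e u v → Joins G e v u
  joins-sym (inj₁ eq) = inj₂ eq
  joins-sym (inj₂ eq) = inj₁ eq

  _++ᵂ_ : ∀ {x y z} → Walk G x y → Walk G y z → Walk G x z
  nil ++ᵂ q = q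
  cons e J p ++ᵂ q = cons e J (p ++ᵂ q)

  reverseᵂ : ∀ {x y} → Walk G x y → Walk G y x
  reverseᵂ nil = nil
  reverseᵂ (cons e J p) = reverseᵂ p ++ᵂ cons e (joins-sym J) nil

  connected-from : ∀ root → (∀ v → Walk G root v) → Connected G
  connected-from root reach u v = reverseᵂ (reach u) ++ᵂ reach v

  OnlyCrossedBy : (Fin (n G) → Bool) → Fin (m G) → Set
  OnlyCrossedBy s e = ∀ f → f ≢ e → s (proj₁ (ends G f)) ≡ s (proj₂ (ends G f))

  Separates : (Fin (n G) → Bool) → Fin (m G) → Set
  Separates s e = s (proj₁ (ends G e)) ≢ s (proj₂ (ends G e)) × OnlyCrossedBy s e

  joins-colour : ∀ (s : Fin (n G) → Bool) {f u v} → s (proj₁ (ends G f)) ≡ s (proj₂ (ends G f)) →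
                 Joins G f u v → s u ≡ s v
  joins-colour s same (inj₁ refl) = same
  joins-colour s same (inj₂ refl) = sym same

  crossing : ∀ s e → OnlyCrossedBy s e → ∀ {x y} (q : Walk G x y) → s x ≢ s y → e ∈ₗ walkEdges G q
  crossing s e only nil x≢x = contradiction refl x≢x
  crossing s e only (cons f J q) x≢y with f Finₚ.≟ e
  ... | yes refl = here refl
  ... | no f≢e =
    there (crossing s e only q λ same → x≢y (trans (joins-colour s (only f f≢e) J) same))

  -- A graph in which every edge separates some colouring is acyclic: the first edge of a
  -- cycle would have to be used again by the rest of the cycle.
  bridges⇒acyclic : (∀ e → Σ (Fin (n G) → Bool) λ s → Separates s e) → Acyclic G
  bridges⇒acyclic bridge u nil ()
  bridges⇒acyclic bridge u (cons e J q) ((e∉rest ∷ _) , _) =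
    All.lookup e∉rest (crossing s e only q (λ same → ends-differ J (sym same))) refl
    where
    s = proj₁ (bridge e)
    only = proj₂ (proj₂ (bridge e))
    ends-differ : ∀ {v} → Joins G e u v → s u ≢ s v
    ends-differ (inj₁ refl) = proj₁ (proj₂ (bridge e))
    ends-differ (inj₂ refl) = proj₁ (proj₂ (bridge e)) ∘ sym

<ᵇ-true : ∀ {m n} → m < n → (m <ᵇ n) ≡ true
<ᵇ-true {m} {n} = dec-true (m <? n)

<ᵇ-false : ∀ {m n} → m ≮ n → (m <ᵇ n) ≡ false
<ᵇ-false {m} {n} = dec-false (m <? n)

<ᵇ-step : ∀ {x y} → x ≢ y → (x <ᵇ y) ≡ (x <ᵇ suc y)
<ᵇ-step {x} {y} x≢y with x <? y
... | yes x<y = trans (<ᵇ-true x<y) (sym (<ᵇ-true (ℕₚ.m<n⇒m<1+n x<y)))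
... | no x≮y =
  trans (<ᵇ-false x≮y) (sym (<ᵇ-false λ x<1+y → x≮y (ℕₚ.≤∧≢⇒< (s≤s⁻¹ x<1+y) x≢y)))

-- An edge set made of X positive and Y negative
-- edges, in which the negative edges are spread over Q legs each contributing p positive
-- and at most p + 1 negative edges, has more positive edges once 3 + 2p ≤ X + Y < 4p:
-- for Q = 0 there is no negative edge, for Q = 1 there are too few edges to balance,
-- and for Q ≥ 2 balancing would need at least 4p edges.
fewer-negatives : ∀ p Q X Y → Q * p ≤ X → Y ≤ Q * suc p →
  3 + (p + p) ≤ X + Y → X + Y < (p + p) + (p + p) → Y < X
fewer-negatives p zero X Y _ Y≤0 large _ rewrite ℕₚ.n≤0⇒n≡0 Y≤0 | ℕₚ.+-identityʳ X =
  ℕₚ.<-≤-trans z<s large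
fewer-negatives p (suc zero) X Y _ Y≤1+p large _ with Y <? X
... | yes Y<X = Y<X
... | no Y≮X = contradiction large (ℕₚ.<⇒≱ (s≤s (begin
  X + Y               ≤⟨ ℕₚ.+-monoˡ-≤ Y (ℕₚ.≮⇒≥ Y≮X) ⟩
  Y + Y               ≤⟨ ℕₚ.+-mono-≤ Y≤ Y≤ ⟩
  suc p + suc p       ≡⟨ cong suc (ℕₚ.+-suc p p) ⟩
  2 + (p + p)         ∎)))
  where
  open ℕₚ.≤-Reasoning
  Y≤ : Y ≤ suc p
  Y≤ = subst (Y ≤_) (ℕₚ.+-identityʳ (suc p)) Y≤1+p
fewer-negatives p (suc (suc q)) X Y 2p≤X _ _ small with Y <? X
... | yes Y<X = Y<X
... | no Y≮X = contradiction small (ℕₚ.≤⇒≯ (begin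
  (p + p) + (p + p)   ≤⟨ ℕₚ.+-mono-≤ p+p≤X p+p≤X ⟩
  X + X               ≤⟨ ℕₚ.+-monoʳ-≤ X (ℕₚ.≮⇒≥ Y≮X) ⟩
  X + Y               ∎))
  where
  open ℕₚ.≤-Reasoning
  p+p≤X : p + p ≤ X
  p+p≤X = ℕₚ.≤-trans (ℕₚ.+-monoʳ-≤ p (ℕₚ.m≤m+n p (q * p))) 2p≤X

-- The spider with d legs, each a path of L = 2p + 1 edges.  Vertex 0 is the centre and
-- vertex suc e is the outer end of edge e; edge combine i t is the t-th edge of leg i.
module Spider (p d : ℕ) where

  L : ℕ
  L = suc (p + p)

  M : ℕ
  M = d * L

  centre : Fin (suc M)
  centre = Fin.zero

  position : Fin M → Fin d × Fin L
  position = remQuot {d} L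

  position-combine : ∀ i t → position (combine i t) ≡ (i , t)
  position-combine = Finₚ.remQuot-combine

  inner : Fin d → Fin L → Fin (suc M)
  inner i Fin.zero = centre
  inner i (Fin.suc t) = Fin.suc (combine i (inject₁ t))

  spider : Graph
  spider = record { n = suc M ; m = M ; ends = λ e → uncurry inner (position e) , Fin.suc e }

  inner-end : ∀ i t → proj₁ (ends spider (combine i t)) ≡ inner i t
  inner-end i t = cong (uncurry inner) (position-combine i t)

  data LegEdge : Fin M → Set where
    leg-edge : (i : Fin d) (t : Fin L) → LegEdge (combine i t)

  leg-edge-view : ∀ e → LegEdge e
  leg-edge-view e = subst LegEdge (Finₚ.combine-remQuot {d} L e) (leg-edge _ _)

  onLeg : Fin d → Fin d → ℕ → ℕ
  onLeg j i x = if does (i Fin.≟ j) then x else 0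

  depth : Fin d → Fin (suc M) → ℕ
  depth j Fin.zero = 0
  depth j (Fin.suc e) = onLeg j (proj₁ (position e)) (suc (toℕ (proj₂ (position e))))

  onLeg-same : ∀ i x → onLeg i i x ≡ x
  onLeg-same i x rewrite dec-true (i Fin.≟ i) refl = refl

  onLeg-other : ∀ {i j} x → i ≢ j → onLeg j i x ≡ 0
  onLeg-other {i} {j} x i≢j rewrite dec-false (i Fin.≟ j) i≢j = refl

  depth-outer : ∀ j i t → depth j (Fin.suc (combine i t)) ≡ onLeg j i (suc (toℕ t))
  depth-outer j i t = cong (λ it → onLeg j (proj₁ it) (suc (toℕ (proj₂ it)))) (position-combine i t)

  depth-inner : ∀ j i t → depth j (inner i t) ≡ onLeg j i (toℕ t)
  depth-inner j i Fin.zero with does (i Fin.≟ j)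
  ... | true = refl
  ... | false = refl
  depth-inner j i (Fin.suc t) =
    trans (depth-outer j i (inject₁ t)) (cong (onLeg j i ∘ suc) (Finₚ.toℕ-inject₁ t))

  beyond : Fin d → Fin L → Fin (suc M) → Bool
  beyond i t v = toℕ t <ᵇ depth i v

  beyond-inner : ∀ i t j u →
    beyond i t (proj₁ (ends spider (combine j u))) ≡ (toℕ t <ᵇ onLeg i j (toℕ u))
  beyond-inner i t j u = cong (toℕ t <ᵇ_) (trans (cong (depth i) (inner-end j u)) (depth-inner i j u))

  beyond-outer : ∀ i t j u →
    beyond i t (Fin.suc (combine j u)) ≡ (toℕ t <ᵇ onLeg i j (suc (toℕ u)))
  beyond-outer i t j u = cong (toℕ t <ᵇ_) (depth-outer i j u)

  separates : ∀ i t → Separates spider (beyond i t) (combine i t)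
  separates i t = split , others
    where
    split : beyond i t (proj₁ (ends spider (combine i t))) ≢ beyond i t (Fin.suc (combine i t))
    split rewrite beyond-inner i t i t | beyond-outer i t i t
                | onLeg-same i (toℕ t) | onLeg-same i (suc (toℕ t))
                | <ᵇ-false (ℕₚ.n≮n (toℕ t)) | <ᵇ-true (ℕₚ.n<1+n (toℕ t)) = λ ()
    others : OnlyCrossedBy spider (beyond i t) (combine i t)
    others f f≢e with leg-edge-view f
    ... | leg-edge j u rewrite beyond-inner i t j u | beyond-outer i t j u with j Fin.≟ i
    ...   | no _ = refl
    ...   | yes refl = <ᵇ-step λ t≡u → f≢e (cong (combine i) (Finₚ.toℕ-injective (sym t≡u)))

  along-leg : ∀ i t → Walk spider centre (Fin.suc (combine i t))
  along-leg i = <-weakInduction (λ t → Walk spider centre (Fin.suc (combine i t)))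
    (step Fin.zero nil)
    (λ t → step (Fin.suc t))
    where
    step : ∀ t → Walk spider centre (inner i t) → Walk spider centre (Fin.suc (combine i t))
    step t to-inner = _++ᵂ_ spider to-inner (cons (combine i t) joins nil)
      where
      joins : Joins spider (combine i t) (inner i t) (Fin.suc (combine i t))
      joins = inj₁ (cong (_, Fin.suc (combine i t)) (inner-end i t))

  reach : ∀ v → Walk spider centre v
  reach Fin.zero = nil
  reach (Fin.suc e) with leg-edge-view e
  ... | leg-edge i t = along-leg i t

  spider-tree : IsTree spider
  spider-tree = connected-from spider centre reach , bridges⇒acyclic spider bridge
    where
    bridge : ∀ e → Σ (Fin (suc M) → Bool) λ s → Separates spider s e
    bridge e with leg-edge-view e
    ... | leg-edge i t = beyond i t , separates i t

  positive : Fin L → Bool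
  positive t = toℕ t <ᵇ p

  weighing : Weighing spider
  weighing e = sign (positive (proj₂ (position e)))

  legCount : (Bool → Bool) → Subset M → Fin d → ℕ
  legCount c S i = count (λ t → lookup S (combine i t) ∧ c (positive t))

  count-by-legs : ∀ c S →
    count (λ e → lookup S e ∧ c (positive (proj₂ (position e)))) ≡ ∑[ i < d ] legCount c S i
  count-by-legs c S = trans (sum-combine d L _) (sum-cong-≗ λ i → sum-cong-≗ λ t →
    cong (λ it → ind (lookup S (combine i t) ∧ c (positive (proj₂ it)))) (position-combine i t))

  weight-by-legs : ∀ S → weightOf spider weighing S ≡ sum (legCount id S) ⊖ sum (legCount not S)
  weight-by-legs S = trans (wsum-sign _ S) (cong₂ _⊖_ (count-by-legs id S) (count-by-legs not S))

  size-by-legs : ∀ S → ∣ S ∣ ≡ sum (legCount id S) + sum (legCount not S)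
  size-by-legs S = trans (card-count S) (trans (count-split (lookup S) (positive ∘ proj₂ ∘ position))
    (cong₂ _+_ (count-by-legs id S) (count-by-legs not S)))

  positives-per-leg : count positive ≡ p
  positives-per-leg = count-below L p (ℕₚ.m≤n⇒m≤1+n (ℕₚ.m≤m+n p p))

  negatives-per-leg : count (not ∘ positive) ≡ suc p
  negatives-per-leg = ℕₚ.+-cancelʳ-≡ p _ _ (begin
    count (not ∘ positive) + p                  ≡⟨ ℕₚ.+-comm _ p ⟩
    p + count (not ∘ positive)                  ≡⟨ cong (_+ count (not ∘ positive)) positives-per-leg ⟨
    count positive + count (not ∘ positive)     ≡⟨ count-split (λ _ → true) positive ⟨
    count {L} (λ _ → true)                      ≡⟨ sum-const L 1 ⟩
    L * 1                                       ≡⟨ ℕₚ.*-identityʳ L ⟩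
    suc p + p                                   ∎)
    where open ≡-Reasoning

  legCount-≤ : ∀ c S i → legCount c S i ≤ count (c ∘ positive)
  legCount-≤ c S i = sum-mono λ t → ind-∧≤ʳ (lookup S (combine i t)) (c (positive t))

  -- The whole spider: d legs of weight p - (p + 1) = -1 each.
  total-weight : totalWeight spider weighing ≡ ℤ.- (ℤ.+ d)
  total-weight = begin
    totalWeight spider weighing
      ≡⟨ weight-by-legs ⊤ ⟩
    sum (legCount id ⊤) ⊖ sum (legCount not ⊤)
      ≡⟨ cong₂ _⊖_ (sum-cong-≗ (full id)) (sum-cong-≗ (full not)) ⟩
    ∑[ i < d ] count positive ⊖ ∑[ i < d ] count (not ∘ positive)
      ≡⟨ cong₂ (λ x y → ∑[ i < d ] x ⊖ ∑[ i < d ] y) positives-per-leg negatives-per-leg ⟩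
    ∑[ i < d ] p ⊖ ∑[ i < d ] suc p
      ≡⟨ cong₂ _⊖_ (sum-const d p) (trans (sum-const d (suc p)) (ℕₚ.*-suc d p)) ⟩
    d * p ⊖ (d + d * p)
      ≡⟨ ℤₚ.⊖-≤ (ℕₚ.m≤n+m (d * p) d) ⟩
    ℤ.- (ℤ.+ (d + d * p ∸ d * p))
      ≡⟨ cong (ℤ.-_ ∘ ℤ.+_) (ℕₚ.m+n∸n≡m d (d * p)) ⟩
    ℤ.- (ℤ.+ d)
      ∎
    where
    open ≡-Reasoning
    full : ∀ c → legCount c ⊤ ≗ λ _ → count (c ∘ positive)
    full c i = sum-cong-≗ λ t →
      cong (λ b → ind (b ∧ c (positive t))) (Vecₚ.lookup-replicate (combine i t) true)

  beyond-own-leg : ∀ i t j u → beyond i t (proj₁ (ends spider (combine j u))) ≡ true → j ≡ i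
  beyond-own-leg i t j u is-beyond with j Fin.≟ i
  ... | yes j≡i = j≡i
  ... | no j≢i = contradiction (trans (sym is-beyond) (trans (beyond-inner i t j u)
                   (cong (toℕ t <ᵇ_) (onLeg-other (toℕ u) j≢i)))) λ ()

  one-leg-small : ∀ (S : Subset M) i →
    (∀ (j : Fin d) (u : Fin L) → lookup S (combine j u) ≡ true → j ≡ i) → ∣ S ∣ ≤ L
  one-leg-small S i on-leg-i = begin
    ∣ S ∣                                                    ≡⟨ card-count S ⟩
    count (lookup S)                                         ≡⟨ sum-combine d L _ ⟩
    ∑[ j < d ] ∑[ u < L ] ind (lookup S (combine j u))       ≡⟨ sum-single _ i other-legs-empty ⟩
    ∑[ u < L ] ind (lookup S (combine i u))                  ≤⟨ sum-mono (λ u → ind≤1 (lookup S (combine i u))) ⟩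
    ∑[ u < L ] 1                                             ≡⟨ sum-const L 1 ⟩
    L * 1                                                    ≡⟨ ℕₚ.*-identityʳ L ⟩
    L                                                        ∎
    where
    open ℕₚ.≤-Reasoning
    other-legs-empty : ∀ j → j ≢ i → ∑[ u < L ] ind (lookup S (combine j u)) ≡ 0
    other-legs-empty j j≢i = sum-zero empty
      where
      empty : ∀ (u : Fin L) → ind (lookup S (combine j u)) ≡ 0
      empty u with lookup S (combine j u) in u∈S
      ... | true = contradiction (on-leg-i j u u∈S) j≢i
      ... | false = refl

  module LocalPositivity (k : ℕ) (k-large : 3 + (p + p) ≤ k) (k-small : k < (p + p) + (p + p))
    (U : Subset (suc M)) (S : Subset M) (sub : IsSubgraph spider U S)
    (conn : ConnectedSub spider U S) (size : ∣ S ∣ ≡ k) where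

    member : ∀ {e} → lookup S e ≡ true → e ∈ S
    member {e} = Vecₚ.lookup⇒[]= e S

    -- If S misses the t'-th edge of leg i but contains an edge further out on that leg,
    -- then every edge of S lies beyond the missing one: a walk in S from the outside to
    -- that further edge would have to cross the missing edge.
    gap-confines : ∀ (i : Fin d) (t t' : Fin L) → lookup S (combine i t) ≡ true →
      toℕ t' ≤ toℕ t → lookup S (combine i t') ≡ false →
      ∀ h → lookup S h ≡ true → beyond i t' (proj₁ (ends spider h)) ≡ true
    gap-confines i t t' t∈S t'≤t gap h h∈S with beyond i t' (proj₁ (ends spider h)) in h-side
    ... | true = refl
    ... | false =
      contradiction (trans (sym gap) (Vecₚ.[]=⇒lookup (All.lookup (proj₂ walk) crosses))) λ ()
      where
      walk = conn (proj₁ (ends spider h)) (Fin.suc (combine i t))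
                  (proj₁ (sub h (member h∈S))) (proj₂ (sub (combine i t) (member t∈S)))
      t-side : beyond i t' (Fin.suc (combine i t)) ≡ true
      t-side = trans (beyond-outer i t' i t)
                     (trans (cong (toℕ t' <ᵇ_) (onLeg-same i _)) (<ᵇ-true (s≤s t'≤t)))
      crosses : combine i t' ∈ₗ walkEdges spider (proj₁ walk)
      crosses = crossing spider (beyond i t') (combine i t') (proj₂ (separates i t')) (proj₁ walk)
                  λ same → contradiction (trans (sym h-side) (trans same t-side)) λ ()

    -- Hence S meets every leg in an initial segment, since S is too large to be confined
    -- to one leg.
    initial-segments : ∀ (i : Fin d) (t t' : Fin L) → lookup S (combine i t) ≡ true →
      toℕ t' ≤ toℕ t → lookup S (combine i t') ≡ true
    initial-segments i t t' t∈S t'≤t with lookup S (combine i t') in gap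
    ... | true = refl
    ... | false = contradiction (one-leg-small S i confined) (ℕₚ.<⇒≱ L<∣S∣)
      where
      confined : ∀ (j : Fin d) (u : Fin L) → lookup S (combine j u) ≡ true → j ≡ i
      confined j u u∈S = beyond-own-leg i t' j u (gap-confines i t t' t∈S t'≤t gap (combine j u) u∈S)
      L<∣S∣ : L < ∣ S ∣
      L<∣S∣ = subst (L <_) (sym size) (ℕₚ.<-≤-trans (ℕₚ.m<n⇒m<1+n (ℕₚ.n<1+n L)) k-large)

    positives-complete : ∀ i → 0 < legCount not S i → legCount id S i ≡ p
    positives-complete i negatives with sum-pos _ negatives
    ... | t , 0<ind with ind-∧-pos (lookup S (combine i t)) (not (positive t)) 0<ind
    ...   | t∈S , t-negative = trans (sum-cong-≗ all-positives) positives-per-leg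
      where
      p≤t : p ≤ toℕ t
      p≤t with toℕ t <? p
      ... | yes t<p = contradiction (trans (sym t-negative) (cong not (<ᵇ-true t<p))) λ ()
      ... | no t≮p = ℕₚ.≮⇒≥ t≮p
      all-positives : ∀ t' → ind (lookup S (combine i t') ∧ positive t') ≡ ind (positive t')
      all-positives t' with toℕ t' <? p
      ... | yes t'<p rewrite <ᵇ-true t'<p
                          | initial-segments i t t' t∈S (ℕₚ.≤-trans (ℕₚ.<⇒≤ t'<p) p≤t) = refl
      ... | no t'≮p rewrite <ᵇ-false t'≮p | Boolₚ.∧-zeroʳ (lookup S (combine i t')) = refl

    used : Fin d → ℕ
    used i = ind (0 <ᵇ legCount not S i)

    Q : ℕ
    Q = sum used

    positives-≥ : Q * p ≤ sum (legCount id S)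
    positives-≥ = subst (_≤ sum (legCount id S)) (sym (*-distribʳ-sum p used)) (sum-mono per-leg)
      where
      per-leg : ∀ i → used i * p ≤ legCount id S i
      per-leg i with legCount not S i in negatives
      ... | zero = z≤n
      ... | suc _ = ℕₚ.≤-reflexive (trans (ℕₚ.+-identityʳ p)
                      (sym (positives-complete i (subst (0 <_) (sym negatives) z<s))))

    negatives-≤ : sum (legCount not S) ≤ Q * suc p
    negatives-≤ = subst (sum (legCount not S) ≤_) (sym (*-distribʳ-sum (suc p) used)) (sum-mono per-leg)
      where
      per-leg : ∀ i → legCount not S i ≤ used i * suc p
      per-leg i with legCount not S i in negatives
      ... | zero = z≤n
      ... | suc m = begin
        suc m                    ≡⟨ negatives ⟨
        legCount not S i         ≤⟨ legCount-≤ not S i ⟩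
        count (not ∘ positive)   ≡⟨ negatives-per-leg ⟩
        suc p                    ≡⟨ ℕₚ.+-identityʳ (suc p) ⟨
        1 * suc p                ∎
        where open ℕₚ.≤-Reasoning

    size-by-signs : k ≡ sum (legCount id S) + sum (legCount not S)
    size-by-signs = trans (sym size) (size-by-legs S)

    positive-weight : ℤ.+ 0 ℤ.< weightOf spider weighing S
    positive-weight = subst (ℤ.+ 0 ℤ.<_) (sym (weight-by-legs S)) (⊖-pos fewer)
      where
      fewer : sum (legCount not S) < sum (legCount id S)
      fewer = fewer-negatives p Q _ _ positives-≥ negatives-≤
        (subst (3 + (p + p) ≤_) size-by-signs k-large) (subst (_< (p + p) + (p + p)) size-by-signs k-small)

  local-positive : ∀ k → 3 + (p + p) ≤ k → k < (p + p) + (p + p) → LocalPositive k spider weighing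
  local-positive k k-large k-small = LocalPositivity.positive-weight k k-large k-small

Admissible : ℕ → ℕ → Set
Admissible k p = 3 + (p + p) ≤ k × k < (p + p) + (p + p)

admissible-step : ∀ {k p} → Admissible k p → Admissible (2 + k) (suc p)
admissible-step {k} {p} (k-large , k-small) = large , small
  where
  open ℕₚ.≤-Reasoning
  two-more : suc p + suc p ≡ 2 + (p + p)
  two-more = cong suc (ℕₚ.+-suc p p)
  shift : ∀ a → a + (2 + a) ≡ 2 + (a + a)
  shift a = trans (ℕₚ.+-suc a (suc a)) (cong suc (ℕₚ.+-suc a a))
  large : 3 + (suc p + suc p) ≤ 2 + k
  large = begin
    3 + (suc p + suc p)  ≡⟨ cong (3 +_) two-more ⟩
    2 + (3 + (p + p))    ≤⟨ ℕₚ.+-monoʳ-≤ 2 k-large ⟩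
    2 + k                ∎
  small : 2 + k < (suc p + suc p) + (suc p + suc p)
  small = begin-strict
    2 + k                              <⟨ ℕₚ.+-monoʳ-< 2 k-small ⟩
    2 + ((p + p) + (p + p))            ≤⟨ ℕₚ.m≤n+m _ 2 ⟩
    2 + (2 + ((p + p) + (p + p)))      ≡⟨ cong (2 +_) (shift (p + p)) ⟨
    2 + ((p + p) + (2 + (p + p)))      ≡⟨ cong (λ x → x + x) two-more ⟨
    (suc p + suc p) + (suc p + suc p)  ∎

admissible : ∀ k → k ≡ 7 ⊎ 9 ≤ k → ∃ (Admissible k)
admissible .7 (inj₁ refl) = 2 , ℕₚ.≤ᵇ⇒≤ 7 7 tt , ℕₚ.≤ᵇ⇒≤ 8 8 tt
admissible k (inj₂ 9≤k) = subst (∃ ∘′ Admissible) (ℕₚ.m+[n∸m]≡n 9≤k) (from-nine (k ∸ 9))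
  where
  from-nine : ∀ j → ∃ (Admissible (9 + j))
  from-nine 0 = 3 , ℕₚ.≤ᵇ⇒≤ 9 9 tt , ℕₚ.≤ᵇ⇒≤ 10 12 tt
  from-nine 1 = 3 , ℕₚ.≤ᵇ⇒≤ 9 10 tt , ℕₚ.≤ᵇ⇒≤ 11 12 tt
  from-nine (suc (suc j)) with from-nine j
  ... | p , p-admissible = suc p , admissible-step p-admissible

far-below : ∀ C N → ¬ C ℤ.≤ ℤ.-[1+ ℤ.∣ C ∣ + N ]
far-below (ℤ.+ c) N ()
far-below ℤ.-[1+ c ] N (ℤ.-≤- c+N<c) = ℕₚ.m+n≮m c N c+N<c

UnboundedBelow : ℕ → Set
UnboundedBelow k = ∀ d → Σ Graph λ G → IsTree G × d ≤ n G ×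
  Σ (Weighing G) λ w → LocalPositive k G w × totalWeight G w ≡ ℤ.- (ℤ.+ d)

unbounded⇒collapses : ∀ k → UnboundedBelow k → Collapses k
unbounded⇒collapses k unbounded = not-forcing , not-weakly-forcing
  where
  not-forcing : ¬ Forcing k
  not-forcing (N , forcing) with unbounded (suc N)
  ... | G , tree , large , w , local , weight
    with subst (ℤ.+ 0 ℤ.<_) weight (forcing G tree (ℕₚ.≤-trans (ℕₚ.n≤1+n N) large) w local)
  ... | ()
  not-weakly-forcing : ¬ WeaklyForcing k
  not-weakly-forcing (_ , C , N , bounded) with unbounded (suc (ℤ.∣ C ∣ + N))
  ... | G , tree , large , w , local , weight =
    far-below C N (subst (C ℤ.≤_) weight (bounded G tree (ℕₚ.≤-trans (ℕₚ.m≤n+m N _) large) w local))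

spiders-unbounded : ∀ {k p} → Admissible k p → UnboundedBelow k
spiders-unbounded {k} {p} (k-large , k-small) d =
  spider , spider-tree , ℕₚ.m≤n⇒m≤1+n (ℕₚ.m≤m*n d L) ,
  weighing , local-positive k k-large k-small , total-weight
  where open Spider p d

lemma3p4 : ∀ (k : ℕ) → (k ≡ 7 ⊎ 9 ≤ k) → Collapses k
lemma3p4 k k-range with admissible k k-range
... | p , p-admissible = unbounded⇒collapses k (spiders-unbounded {p = p} p-admissible)
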